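{- In $\mathbb{Z}_{93}$ let $H=\{1,25,67\}$, and write $HS=\{hs\bmod 93: h\in H, s\in S\}$. Let $X=H\{0,1,2,3,5,8,10,12,13,16,22,24,43,44,47,48\}$ and $Y=H\{0,1,3,4,5,9,11,12,18,20,22,37,40,43,44,51\}$. Then $(X,Y)$ is a difference family in $\mathbb{Z}_{93}$ with parameters $(93;46,46;45)$; consequently a cyclic Legendre pair of length $93$ exists.
   Context: A pair $(X,Y)$ of subsets of $\mathbb{Z}_v$ with $|X|=k_1$, $|Y|=k_2$ is a difference family with parameters $(v;k_1,k_2;\lambda)$ if every nonzero $d\in\mathbb{Z}_v$ arises as $x-x'$ ($x,x'\in X$) or $y-y'$ ($y,y'\in Y$) in exactly $\lambda$ ways in total. A cyclic Legendre pair of length $v$ is a pair of functions $f,g:\mathbb{Z}_v\to\{+1,-1\}$ with $\sum_{x}f(x)f(x+s)+\sum_x g(x)g(x+s)=-2$ for all nonzero $s\in\mathbb{Z}_v$; it corresponds to the difference family $(\{f=-1\},\{g=-1\})$ with $\lambda=k_1+k_2-(v+1)/2$. -}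

module Defs where

open import Data.Nat as ℕ using (ℕ; NonZero; _∸_)
open import Data.Nat.DivMod using (_mod_; _%_)
open import Data.Fin using (Fin; toℕ)
open import Data.Fin.Subset using (Subset; _∈_; ∣_∣)
open import Data.Fin.Subset.Properties using (_∈?_)
open import Data.Bool using (Bool)
open import Data.List as List using (List; allFin; length; filter; cartesianProduct)
open import Data.Bool.ListAction using (any)
open import Data.Vec using (tabulate)
open import Data.Product using (_×_; _,_; proj₁; proj₂; ∃₂)
open import Data.Integer as ℤ using (ℤ)
open import Relation.Binary.PropositionalEquality using (_≡_; _≢_)
open import Relation.Nullary using (⌊_⌋)
open import Relation.Nullary.Decidable using (_×-dec_)
open import Data.Fin.Properties using (_≟_)
import Data.Nat.Properties as ℕP
open import Data.Sum using (_⊎_)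

_+ₘ_ : {n : ℕ} .{{_ : NonZero n}} → Fin n → Fin n → Fin n
_+ₘ_ {n} a b = (toℕ a ℕ.+ toℕ b) mod n

_-ₘ_ : {n : ℕ} .{{_ : NonZero n}} → Fin n → Fin n → Fin n
_-ₘ_ {n} a b = (toℕ a ℕ.+ (n ∸ toℕ b)) mod n

zeroₘ : {n : ℕ} .{{_ : NonZero n}} → Fin n
zeroₘ {n} = 0 mod n

prodSet : (n : ℕ) .{{_ : NonZero n}} → List ℕ → List ℕ → Subset n
prodSet n H S =
  tabulate λ z → any (λ h → any (λ s → ⌊ z ≟ ((h ℕ.* s) mod n) ⌋) S) H

diffCount : {n : ℕ} .{{_ : NonZero n}} → Subset n → Fin n → ℕ
diffCount {n} A d =
  length (filter (λ p → (proj₁ p ∈? A) ×-dec ((proj₂ p ∈? A) ×-dec ((proj₁ p -ₘ proj₂ p) ≟ d)))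
                 (cartesianProduct (allFin n) (allFin n)))

IsDifferenceFamily : (v : ℕ) .{{_ : NonZero v}} → Subset v → Subset v → ℕ → ℕ → ℕ → Set
IsDifferenceFamily v X Y k₁ k₂ λ′ =
  ∣ X ∣ ≡ k₁ × ∣ Y ∣ ≡ k₂ ×
  (∀ (d : Fin v) → d ≢ zeroₘ → diffCount X d ℕ.+ diffCount Y d ≡ λ′)

sumFin : (v : ℕ) → (Fin v → ℤ) → ℤ
sumFin v f = List.foldr ℤ._+_ (ℤ.+ 0) (List.map f (allFin v))

paf : (v : ℕ) .{{_ : NonZero v}} → (Fin v → ℤ) → Fin v → ℤ
paf v f s = sumFin v (λ x → f x ℤ.* f (x +ₘ s))

IsPlusMinusOne : {v : ℕ} → (Fin v → ℤ) → Set
IsPlusMinusOne f = ∀ x → (f x ≡ ℤ.+ 1) ⊎ (f x ≡ ℤ.-[1+ 0 ])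

IsLegendrePair : (v : ℕ) .{{_ : NonZero v}} → (Fin v → ℤ) → (Fin v → ℤ) → Set
IsLegendrePair v f g =
  IsPlusMinusOne f × IsPlusMinusOne g ×
  (∀ (s : Fin v) → s ≢ zeroₘ → paf v f s ℤ.+ paf v g s ≡ ℤ.-[1+ 1 ])

H93 : List ℕ
H93 = 1 List.∷ 25 List.∷ 67 List.∷ List.[]

SX : List ℕ
SX = 0 List.∷ 1 List.∷ 2 List.∷ 3 List.∷ 5 List.∷ 8 List.∷ 10 List.∷ 12 List.∷ 13 List.∷ 16 List.∷ 22 List.∷ 24 List.∷ 43 List.∷ 44 List.∷ 47 List.∷ 48 List.∷ List.[]

SY : List ℕ
SY = 0 List.∷ 1 List.∷ 3 List.∷ 4 List.∷ 5 List.∷ 9 List.∷ 11 List.∷ 12 List.∷ 18 List.∷ 20 List.∷ 22 List.∷ 37 List.∷ 40 List.∷ 43 List.∷ 44 List.∷ 51 List.∷ List.[]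

X93 : Subset 93
X93 = prodSet 93 H93 SX

Y93 : Subset 93
Y93 = prodSet 93 H93 SY

module Submission where

-- In ℤ_n the equation x − y = d has, for each x, the single solution y = x − d, so the number
-- of ordered pairs of A with difference d is the number of x ∈ A with x − d ∈ A. This turns the
-- difference-family condition into a check of 93 memberships per shift; it and the periodic
-- autocorrelation identity for the ±1 indicators of X and Y (which are −1 exactly on X and Y)
-- are then decided by evaluation at each of the 92 nonzero shifts.

open import Defs
open import Data.Bool using (true; false; if_then_else_)
open import Data.Fin using (Fin; toℕ)
open import Data.Fin.Properties using (_≟_; toℕ-injective; toℕ<n; toℕ≤n; toℕ-fromℕ<; all?)
open import Data.Fin.Subset using (Subset; _∈_)
open import Data.Fin.Subset.Properties using (_∈?_)
open import Data.Integer using (ℤ; +_; -[1+_])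
import Data.Integer as ℤ
import Data.Integer.Properties as ℤ
open import Data.List using (List; []; _∷_; [_]; _++_; length; filter; map; cartesianProduct; allFin)
open import Data.List.Properties using (filter-++; length-++; filter-accept; filter-reject; filter-none; filter-≐)
open import Data.List.Relation.Unary.All as All using (All)
open import Data.List.Relation.Unary.Unique.Propositional using (Unique)
open import Data.List.Relation.Unary.Unique.Propositional.Properties using (allFin⁺)
open import Data.List.Relation.Unary.AllPairs using (_∷_)
open import Data.List.Membership.Propositional using () renaming (_∈_ to _∈ₗ_)
open import Data.List.Membership.Propositional.Properties using (∈-allFin)
open import Data.List.Relation.Unary.Any using (here; there)
open import Data.Nat as ℕ using (ℕ; NonZero; _+_; _∸_; _≤_; _<_; suc)
open import Data.Nat.DivMod using (_%_; _mod_; m%n<n; [m+n]%n≡m%n; %-distribˡ-+; m%n%n≡m%n; m<n⇒m%n≡m)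
import Data.Nat.Properties as ℕ
open import Data.Product using (_×_; _,_; proj₁; proj₂; ∃₂)
open import Data.Sum using (inj₁; inj₂)
open import Function using (_∘_)
open import Relation.Binary.Definitions using (DecidableEquality)
open import Relation.Binary.PropositionalEquality using (_≡_; _≢_; refl; sym; trans; cong; cong₂; subst; module ≡-Reasoning)
open import Relation.Nullary using (Dec; yes; no; does; ¬_; ¬?)
open import Relation.Nullary.Decidable using (toWitness; _×-dec_; _→-dec_)
open import Relation.Unary using (Pred; Decidable)

open ≡-Reasoning

module _ {b p} {B : Set b} {P : Pred B p} (P? : Decidable P) where

  length-filter-++ : ∀ (xs ys : List B) →
    length (filter P? (xs ++ ys)) ≡ length (filter P? xs) + length (filter P? ys)
  length-filter-++ xs ys = trans (cong length (filter-++ P? xs ys)) (length-++ (filter P? xs))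

  length-filter-map : ∀ {a} {A : Set a} (f : A → B) (xs : List A) →
    length (filter P? (map f xs)) ≡ length (filter (P? ∘ f) xs)
  length-filter-map f [] = refl
  length-filter-map f (x ∷ xs) with does (P? (f x))
  ... | true  = cong suc (length-filter-map f xs)
  ... | false = length-filter-map f xs

length-filter-cartesianProduct :
  ∀ {a b p r} {A : Set a} {B : Set b} {P : Pred (A × B) p} {R : Pred A r}
  (P? : Decidable P) (R? : Decidable R) {ys : List B} →
  (∀ x → length (filter P? (map (x ,_) ys)) ≡ length (filter R? [ x ])) →
  ∀ xs → length (filter P? (cartesianProduct xs ys)) ≡ length (filter R? xs)
length-filter-cartesianProduct P? R? {ys} row [] = refl
length-filter-cartesianProduct P? R? {ys} row (x ∷ xs) = begin
  length (filter P? (map (x ,_) ys ++ cartesianProduct xs ys))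
    ≡⟨ length-filter-++ P? (map (x ,_) ys) (cartesianProduct xs ys) ⟩
  length (filter P? (map (x ,_) ys)) + length (filter P? (cartesianProduct xs ys))
    ≡⟨ cong₂ _+_ (row x) (length-filter-cartesianProduct P? R? row xs) ⟩
  length (filter R? [ x ]) + length (filter R? xs)
    ≡⟨ length-filter-++ R? [ x ] xs ⟨
  length (filter R? (x ∷ xs)) ∎

length-filter-≟-unique : ∀ {a} {A : Set a} (_≟ᴬ_ : DecidableEquality A) {z : A} {xs : List A} →
  Unique xs → z ∈ₗ xs → length (filter (_≟ᴬ z) xs) ≡ 1
length-filter-≟-unique _≟ᴬ_ {z} {x ∷ xs} (x∉xs ∷ _) (here z≡x) = begin
  length (filter (_≟ᴬ z) (x ∷ xs)) ≡⟨ cong length (filter-accept (_≟ᴬ z) (sym z≡x)) ⟩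
  suc (length (filter (_≟ᴬ z) xs)) ≡⟨ cong (suc ∘ length) (filter-none (_≟ᴬ z) (All.map (λ x≢y y≡z → x≢y (trans (sym z≡x) (sym y≡z))) x∉xs)) ⟩
  1                                 ∎
length-filter-≟-unique _≟ᴬ_ {z} {x ∷ xs} (x∉xs ∷ unique) (there z∈xs) = begin
  length (filter (_≟ᴬ z) (x ∷ xs)) ≡⟨ cong length (filter-reject (_≟ᴬ z) (All.lookup x∉xs z∈xs)) ⟩
  length (filter (_≟ᴬ z) xs)       ≡⟨ length-filter-≟-unique _≟ᴬ_ unique z∈xs ⟩
  1                                 ∎

toℕ-mod : ∀ m n .{{_ : NonZero n}} → toℕ (m mod n) ≡ m % n
toℕ-mod m n = toℕ-fromℕ< (m%n<n m n)

[m%o+n]%o≡[m+n]%o : ∀ m n o .{{_ : NonZero o}} → (m % o + n) % o ≡ (m + n) % o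
[m%o+n]%o≡[m+n]%o m n o = begin
  (m % o + n) % o         ≡⟨ %-distribˡ-+ (m % o) n o ⟩
  (m % o % o + n % o) % o ≡⟨ cong (λ k → (k + n % o) % o) (m%n%n≡m%n m o) ⟩
  (m % o + n % o) % o     ≡⟨ %-distribˡ-+ m n o ⟨
  (m + n) % o             ∎

[m+n%o]%o≡[m+n]%o : ∀ m n o .{{_ : NonZero o}} → (m + n % o) % o ≡ (m + n) % o
[m+n%o]%o≡[m+n]%o m n o = begin
  (m + n % o) % o ≡⟨ cong (_% o) (ℕ.+-comm m (n % o)) ⟩
  (n % o + m) % o ≡⟨ [m%o+n]%o≡[m+n]%o n m o ⟩
  (n + m) % o     ≡⟨ cong (_% o) (ℕ.+-comm n m) ⟩
  (m + n) % o     ∎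

module _ {m n o p : ℕ} .{{_ : NonZero n}} (o≤n : o ≤ n) where

  [m+[n∸o]]%n≡p⇒m%n≡[o+p]%n : (m + (n ∸ o)) % n ≡ p → m % n ≡ (o + p) % n
  [m+[n∸o]]%n≡p⇒m%n≡[o+p]%n eq = begin
    m % n                         ≡⟨ [m+n]%n≡m%n m n ⟨
    (m + n) % n                   ≡⟨ cong (λ k → (m + k) % n) (ℕ.m+[n∸m]≡n o≤n) ⟨
    (m + (o + (n ∸ o))) % n       ≡⟨ cong (_% n) (ℕ.+-comm m (o + (n ∸ o))) ⟩
    (o + (n ∸ o) + m) % n         ≡⟨ cong (_% n) (ℕ.+-assoc o (n ∸ o) m) ⟩
    (o + ((n ∸ o) + m)) % n       ≡⟨ cong (λ k → (o + k) % n) (ℕ.+-comm (n ∸ o) m) ⟩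
    (o + (m + (n ∸ o))) % n       ≡⟨ [m+n%o]%o≡[m+n]%o o (m + (n ∸ o)) n ⟨
    (o + (m + (n ∸ o)) % n) % n   ≡⟨ cong (λ k → (o + k) % n) eq ⟩
    (o + p) % n                   ∎

  m%n≡[o+p]%n⇒[m+[n∸o]]%n≡p : p < n → m % n ≡ (o + p) % n → (m + (n ∸ o)) % n ≡ p
  m%n≡[o+p]%n⇒[m+[n∸o]]%n≡p p<n eq = begin
    (m + (n ∸ o)) % n             ≡⟨ [m%o+n]%o≡[m+n]%o m (n ∸ o) n ⟨
    (m % n + (n ∸ o)) % n         ≡⟨ cong (λ k → (k + (n ∸ o)) % n) eq ⟩
    ((o + p) % n + (n ∸ o)) % n   ≡⟨ [m%o+n]%o≡[m+n]%o (o + p) (n ∸ o) n ⟩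
    (o + p + (n ∸ o)) % n         ≡⟨ cong (λ k → (k + (n ∸ o)) % n) (ℕ.+-comm o p) ⟩
    (p + o + (n ∸ o)) % n         ≡⟨ cong (_% n) (ℕ.+-assoc p o (n ∸ o)) ⟩
    (p + (o + (n ∸ o))) % n       ≡⟨ cong (λ k → (p + k) % n) (ℕ.m+[n∸m]≡n o≤n) ⟩
    (p + n) % n                   ≡⟨ [m+n]%n≡m%n p n ⟩
    p % n                         ≡⟨ m<n⇒m%n≡m p<n ⟩
    p                             ∎

x-ₘy≡d⇒x-ₘd≡y : ∀ {n} .{{_ : NonZero n}} (x y d : Fin n) → x -ₘ y ≡ d → x -ₘ d ≡ y
x-ₘy≡d⇒x-ₘd≡y {n} x y d eq = toℕ-injective (begin
  toℕ (x -ₘ d)                  ≡⟨ toℕ-mod (toℕ x + (n ∸ toℕ d)) n ⟩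
  (toℕ x + (n ∸ toℕ d)) % n     ≡⟨ m%n≡[o+p]%n⇒[m+[n∸o]]%n≡p (toℕ≤n d) (toℕ<n y) x≡d+y ⟩
  toℕ y                         ∎)
  where
  x≡y+d : toℕ x % n ≡ (toℕ y + toℕ d) % n
  x≡y+d = [m+[n∸o]]%n≡p⇒m%n≡[o+p]%n (toℕ≤n y)
            (trans (sym (toℕ-mod (toℕ x + (n ∸ toℕ y)) n)) (cong toℕ eq))
  x≡d+y : toℕ x % n ≡ (toℕ d + toℕ y) % n
  x≡d+y = trans x≡y+d (cong (_% n) (ℕ.+-comm (toℕ y) (toℕ d)))

overlapCount : ∀ {n} .{{_ : NonZero n}} → Subset n → Fin n → ℕ
overlapCount {n} A d = length (filter (λ x → (x ∈? A) ×-dec ((x -ₘ d) ∈? A)) (allFin n))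

diffCount≡overlapCount : ∀ {n} .{{_ : NonZero n}} (A : Subset n) (d : Fin n) →
  diffCount A d ≡ overlapCount A d
diffCount≡overlapCount {n} A d =
  length-filter-cartesianProduct P? R? row (allFin n)
  where
  P? : (p : Fin n × Fin n) → Dec (proj₁ p ∈ A × (proj₂ p ∈ A × (proj₁ p -ₘ proj₂ p) ≡ d))
  P? (x , y) = (x ∈? A) ×-dec ((y ∈? A) ×-dec ((x -ₘ y) ≟ d))

  R? : (x : Fin n) → Dec (x ∈ A × (x -ₘ d) ∈ A)
  R? x = (x ∈? A) ×-dec ((x -ₘ d) ∈? A)

  solutions : ∀ x → Dec (x ∈ A × (x -ₘ d) ∈ A) →
    length (filter (P? ∘ (x ,_)) (allFin n)) ≡ length (filter R? [ x ])
  solutions x (yes (x∈A , x-d∈A)) = begin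
    length (filter (P? ∘ (x ,_)) (allFin n))    ≡⟨ cong length (filter-≐ (P? ∘ (x ,_)) (_≟ (x -ₘ d)) (to , from) (allFin n)) ⟩
    length (filter (_≟ (x -ₘ d)) (allFin n))    ≡⟨ length-filter-≟-unique _≟_ (allFin⁺ n) (∈-allFin (x -ₘ d)) ⟩
    1                                           ≡⟨ cong length (filter-accept R? (x∈A , x-d∈A)) ⟨
    length (filter R? [ x ])                    ∎
    where
    to : ∀ {y} → x ∈ A × (y ∈ A × (x -ₘ y) ≡ d) → y ≡ x -ₘ d
    to (_ , _ , x-y≡d) = sym (x-ₘy≡d⇒x-ₘd≡y x _ d x-y≡d)
    from : ∀ {y} → y ≡ x -ₘ d → x ∈ A × (y ∈ A × (x -ₘ y) ≡ d)
    from refl = x∈A , x-d∈A , x-ₘy≡d⇒x-ₘd≡y x d (x -ₘ d) refl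
  solutions x (no ¬Rx) = begin
    length (filter (P? ∘ (x ,_)) (allFin n))    ≡⟨ cong length (filter-none (P? ∘ (x ,_)) (All.universal noSolution (allFin n))) ⟩
    0                                           ≡⟨ cong length (filter-reject R? ¬Rx) ⟨
    length (filter R? [ x ])                    ∎
    where
    noSolution : ∀ y → ¬ (x ∈ A × (y ∈ A × (x -ₘ y) ≡ d))
    noSolution y (x∈A , y∈A , x-y≡d) = ¬Rx (x∈A , subst (_∈ A) (sym (x-ₘy≡d⇒x-ₘd≡y x y d x-y≡d)) y∈A)

  row : ∀ x → length (filter P? (map (x ,_) (allFin n))) ≡ length (filter R? [ x ])
  row x = trans (length-filter-map P? (x ,_) (allFin n)) (solutions x (R? x))

signOf : ∀ {n} → Subset n → Fin n → ℤ
signOf A x = if does (x ∈? A) then -[1+ 0 ] else + 1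

signOf-isPlusMinusOne : ∀ {n} (A : Subset n) → IsPlusMinusOne (signOf A)
signOf-isPlusMinusOne A x with does (x ∈? A)
... | true  = inj₂ refl
... | false = inj₁ refl

overlapCount-X93+Y93 : ∀ d → d ≢ zeroₘ → overlapCount X93 d + overlapCount Y93 d ≡ 45
overlapCount-X93+Y93 = toWitness {a? = all? λ d →
  ¬? (d ≟ zeroₘ) →-dec (overlapCount X93 d + overlapCount Y93 d ℕ.≟ 45)} _

paf-X93+Y93 : ∀ s → s ≢ zeroₘ → paf 93 (signOf X93) s ℤ.+ paf 93 (signOf Y93) s ≡ -[1+ 1 ]
paf-X93+Y93 = toWitness {a? = all? λ s →
  ¬? (s ≟ zeroₘ) →-dec (paf 93 (signOf X93) s ℤ.+ paf 93 (signOf Y93) s ℤ.≟ -[1+ 1 ])} _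

mainTheorem3 : IsDifferenceFamily 93 X93 Y93 46 46 45
    × ∃₂ (λ (f g : Fin 93 → ℤ) → IsLegendrePair 93 f g)
mainTheorem3 = (refl , refl , differences)
             , signOf X93 , signOf Y93
             , signOf-isPlusMinusOne X93 , signOf-isPlusMinusOne Y93 , paf-X93+Y93
  where
  differences : ∀ d → d ≢ zeroₘ → diffCount X93 d + diffCount Y93 d ≡ 45
  differences d d≢0 = begin
    diffCount X93 d + diffCount Y93 d
      ≡⟨ cong₂ _+_ (diffCount≡overlapCount X93 d) (diffCount≡overlapCount Y93 d) ⟩
    overlapCount X93 d + overlapCount Y93 d
      ≡⟨ overlapCount-X93+Y93 d d≢0 ⟩
    45 ∎
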